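{- Let $G$ and $H$ be two connected graphs of orders $n_1\ge 2$ and $n_2\ge 2$ and maximum degrees $\Delta_1$ and $\Delta_2$, respectively. (i) If $\Delta_1\ne n_1-1$ or $\Delta_2\ne n_2-1$, then $\dim_s(G+H)=n_1+n_2-\varpi(G)-\varpi(H)\ge \dim_s(G)+\dim_s(H)$. (ii) If $G$ and $H$ both have diameter two and $\Delta_1\ne n_1-1$ or $\Delta_2\ne n_2-1$, then $\dim_s(G+H)=\dim_s(G)+\dim_s(H)$. (iii) If $\Delta_1=n_1-1$ and $\Delta_2=n_2-1$, then $\dim_s(G+H)=\dim_s(G)+\dim_s(H)+1$.
   Context: All graphs are finite and simple. For a connected graph $X$, $I_X[u,v]$ is the set of vertices on some shortest $u$–$v$ path; a vertex $w$ strongly resolves $u,v$ if $v\in I_X[u,w]$ or $u\in I_X[v,w]$; a strong resolving set is a vertex set $S$ such that every two distinct vertices are strongly resolved by some vertex of $S$; $\dim_s(X)$ is the minimum size of a strong resolving set. The join $G+H$ is obtained from disjoint copies of $G$ and $H$ by joining every vertex of $G$ to every vertex of $H$. True twins are distinct vertices with equal closed neighborhoods; a twin-free clique is a clique containing no two true twins; $\varpi(X)$ is the maximum size of a twin-free clique of $X$. -}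

module Defs where

open import Data.Nat using (ℕ; zero; suc; _+_; _≤_; _<_)
open import Data.Bool using (Bool; true; false)
open import Data.Fin using (Fin; splitAt)
open import Data.Fin.Subset using (Subset; _∈_; ∣_∣)
open import Data.Vec using (tabulate)
open import Data.Sum using (_⊎_; inj₁; inj₂)
open import Data.Product using (Σ; _×_; _,_; ∃; ∃-syntax)
open import Relation.Nullary using (¬_)
open import Relation.Binary.PropositionalEquality using (_≡_; _≢_; refl)

record Graph (n : ℕ) : Set where
  field
    adj    : Fin n → Fin n → Bool
    sym    : ∀ u v → adj u v ≡ adj v u
    irrefl : ∀ v → adj v v ≡ false
open Graph public

module _ {n : ℕ} (G : Graph n) where

  Adj : Fin n → Fin n → Set
  Adj u v = adj G u v ≡ true

  data Walk : Fin n → Fin n → ℕ → Set where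
    nil  : ∀ {u} → Walk u u 0
    cons : ∀ {u x v k} → Adj u x → Walk x v k → Walk u v (suc k)

  data OnWalk (w : Fin n) : ∀ {u v k} → Walk u v k → Set where
    here  : ∀ {v k} {p : Walk w v k} → OnWalk w p
    there : ∀ {u x v k} {a : Adj u x} {p : Walk x v k} → OnWalk w p → OnWalk w (cons a p)

  Connected : Set
  Connected = ∀ u v → ∃[ k ] Walk u v k

  Dist : Fin n → Fin n → ℕ → Set
  Dist u v d = Walk u v d × (∀ j → j < d → ¬ Walk u v j)

  Diameter2 : Set
  Diameter2 = (∀ u v d → Dist u v d → d ≤ 2) × (∃[ u ] ∃[ v ] Dist u v 2)

  -- w ∈ I[u,v]: w lies on some shortest u–v path
  InInterval : Fin n → Fin n → Fin n → Set
  InInterval u v w = ∃[ k ] (Σ (Walk u v k) (OnWalk w) × (∀ j → j < k → ¬ Walk u v j))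

  StronglyResolves : Fin n → Fin n → Fin n → Set
  StronglyResolves w u v = InInterval u w v ⊎ InInterval v w u

  StrongResolvingSet : Subset n → Set
  StrongResolvingSet S = ∀ u v → u ≢ v → ∃[ w ] (w ∈ S × StronglyResolves w u v)

  StrongMetricDim : ℕ → Set
  StrongMetricDim k =
    (∃[ S ] (StrongResolvingSet S × ∣ S ∣ ≡ k)) ×
    (∀ S → StrongResolvingSet S → k ≤ ∣ S ∣)

  degree : Fin n → ℕ
  degree v = ∣ tabulate (adj G v) ∣

  MaxDegree : ℕ → Set
  MaxDegree d = (∃[ v ] degree v ≡ d) × (∀ v → degree v ≤ d)

  ClosedNbr : Fin n → Fin n → Set
  ClosedNbr u w = w ≡ u ⊎ Adj u w

  TrueTwins : Fin n → Fin n → Set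
  TrueTwins u v = u ≢ v × (∀ w → (ClosedNbr u w → ClosedNbr v w) × (ClosedNbr v w → ClosedNbr u w))

  IsClique : Subset n → Set
  IsClique S = ∀ u v → u ∈ S → v ∈ S → u ≢ v → Adj u v

  TwinFreeClique : Subset n → Set
  TwinFreeClique S = IsClique S × (∀ u v → u ∈ S → v ∈ S → ¬ TrueTwins u v)

  TwinFreeCliqueNumber : ℕ → Set
  TwinFreeCliqueNumber k =
    (∃[ S ] (TwinFreeClique S × ∣ S ∣ ≡ k)) ×
    (∀ S → TwinFreeClique S → ∣ S ∣ ≤ k)

-- The join G + H on vertex set Fin (n₁ + n₂): first n₁ vertices are G, the rest H.
joinAdj : ∀ {n₁ n₂} → Graph n₁ → Graph n₂ → Fin n₁ ⊎ Fin n₂ → Fin n₁ ⊎ Fin n₂ → Bool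
joinAdj G H (inj₁ a) (inj₁ b) = adj G a b
joinAdj G H (inj₂ a) (inj₂ b) = adj H a b
joinAdj G H (inj₁ _) (inj₂ _) = true
joinAdj G H (inj₂ _) (inj₁ _) = true

joinAdj-sym : ∀ {n₁ n₂} (G : Graph n₁) (H : Graph n₂) x y → joinAdj G H x y ≡ joinAdj G H y x
joinAdj-sym G H (inj₁ a) (inj₁ b) = sym G a b
joinAdj-sym G H (inj₂ a) (inj₂ b) = sym H a b
joinAdj-sym G H (inj₁ _) (inj₂ _) = refl
joinAdj-sym G H (inj₂ _) (inj₁ _) = refl

joinAdj-irrefl : ∀ {n₁ n₂} (G : Graph n₁) (H : Graph n₂) x → joinAdj G H x x ≡ false
joinAdj-irrefl G H (inj₁ a) = irrefl G a
joinAdj-irrefl G H (inj₂ a) = irrefl H a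

_+ᴳ_ : ∀ {n₁ n₂} → Graph n₁ → Graph n₂ → Graph (n₁ + n₂)
_+ᴳ_ {n₁} G H = record
  { adj    = λ x y → joinAdj G H (splitAt n₁ x) (splitAt n₁ y)
  ; sym    = λ x y → joinAdj-sym G H (splitAt n₁ x) (splitAt n₁ y)
  ; irrefl = λ x → joinAdj-irrefl G H (splitAt n₁ x)
  }

module Submission where

-- For a connected graph of order n, the complement of a twin-free clique is a strong resolving
-- set: two clique vertices that are not true twins are separated by a private neighbour of one
-- of them, which lies outside the clique.  If the diameter is at most two the converse holds:
-- a vertex w strongly resolving u and v sits at distance two from one of them, with the other
-- in between, so u and v are adjacent and w is a private neighbour.  Hence dim_s + ϖ = n for
-- such graphs, in particular for every join, whose diameter is at most two.
-- A twin-free clique of G + H is a twin-free clique of G next to one of H, and the only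
-- obstruction to gluing two such cliques is a universal vertex on each side, since those are
-- true twins in G + H.  So ϖ(G + H) = ϖ(G) + ϖ(H) unless both G and H have a universal vertex
-- (i.e. Δᵢ = nᵢ − 1), in which case every maximum twin-free clique contains one and
-- ϖ(G + H) = ϖ(G) + ϖ(H) − 1; graphs with a universal vertex have diameter at most two.

open import Defs
open import Data.Nat using (ℕ; zero; suc; _+_; _∸_; _≤_; _<_; z≤n; s≤s)
open import Data.Nat.Induction using (<-rec)
open import Data.Nat.Properties as ℕ using (anyUpTo?)
open import Algebra.Properties.CommutativeSemigroup ℕ.+-commutativeSemigroup
  using () renaming (interchange to +-interchange)
open import Data.Bool using (Bool; true)
open import Data.Bool.Properties using () renaming (_≟_ to _≟ᵇ_)
open import Data.Fin using (Fin; zero; suc; _↑ˡ_; _↑ʳ_; splitAt; fromℕ<)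
open import Data.Fin.Properties
  using (any?; all?; ¬∀⟶∃¬; splitAt-↑ˡ; splitAt-↑ʳ; splitAt⁻¹-↑ˡ; splitAt⁻¹-↑ʳ; ↑ˡ-injective; ↑ʳ-injective)
  renaming (_≟_ to _≟ᶠ_)
open import Data.Fin.Subset using (Subset; _∈_; _∉_; ∣_∣; ∁; _∪_; ⁅_⁆; _⊆_; _⊂_; _-_; inside; outside)
open import Data.Fin.Subset.Properties
  using (_∈?_; x∈∁p⇒x∉p; x∉p⇒x∈∁p; ∣∁p∣≡n∸∣p∣; ∣p∣≤n; p─⊥≡p; ∣⁅x⁆∣≡1; x∈⁅y⁆⇒x≡y; x∉⁅y⁆⇒x≢y;
         x≢y⇒x∉⁅y⁆; p⊆q⇒∣p∣≤∣q∣; p⊂q⇒∣p∣<∣q∣; x∈p∪q⁻; x∈⁅x⁆; p⊆p∪q; q⊆p∪q; p─q⊆p)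
open import Data.Sum as Sum using (_⊎_; inj₁; inj₂)
open import Data.Vec using (_∷_; []; _++_; here; there; tabulate; take; drop)
open import Data.Vec.Properties
  using (lookup∘tabulate; []=⇒lookup; lookup⇒[]=; lookup-++ˡ; lookup-++ʳ; take++drop≡id)
open import Data.Product using (_×_; _,_; ∃; ∃-syntax; proj₁; proj₂)
open import Data.Empty using (⊥-elim)
open import Function using (_∘_; _⇔_; mk⇔; Equivalence)
open import Relation.Nullary using (¬_; Dec; yes; no; contradiction)
open import Relation.Nullary.Decidable using (_×-dec_; _→-dec_; _⊎-dec_)
open import Relation.Binary.PropositionalEquality as ≡
  using (_≡_; _≢_; refl; trans; cong; cong₂; subst)

least-witness : ∀ {p} {P : ℕ → Set p} → (∀ k → Dec (P k)) →
                ∀ {k} → P k → ∃[ j ] (P j × ∀ i → i < j → ¬ P i)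
least-witness {P = P} P? {k} = <-rec (λ k → P k → ∃[ j ] (P j × ∀ i → i < j → ¬ P i)) step k
  where
  step : ∀ k → (∀ {j} → j < k → P j → ∃[ j ] (P j × ∀ i → i < j → ¬ P i)) →
         P k → ∃[ j ] (P j × ∀ i → i < j → ¬ P i)
  step k rec pk with anyUpTo? P? k
  ... | yes (j , j<k , pj) = rec j<k pj
  ... | no none = k , pk , λ i i<k pi → none (i , i<k , pi)

∣p∣+∣∁p∣≡n : ∀ {n} (p : Subset n) → ∣ p ∣ + ∣ ∁ p ∣ ≡ n
∣p∣+∣∁p∣≡n p = trans (cong (∣ p ∣ +_) (∣∁p∣≡n∸∣p∣ p)) (ℕ.m+[n∸m]≡n (∣p∣≤n p))

x∈p⇒∣p∣≡1+∣p-x∣ : ∀ {n} {p : Subset n} {x} → x ∈ p → ∣ p ∣ ≡ suc ∣ p - x ∣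
x∈p⇒∣p∣≡1+∣p-x∣ {p = inside ∷ p} here = cong suc (≡.sym (cong ∣_∣ (p─⊥≡p p)))
x∈p⇒∣p∣≡1+∣p-x∣ {p = inside ∷ p} (there x∈p) = cong suc (x∈p⇒∣p∣≡1+∣p-x∣ x∈p)
x∈p⇒∣p∣≡1+∣p-x∣ {p = outside ∷ p} (there x∈p) = x∈p⇒∣p∣≡1+∣p-x∣ x∈p

x∉p-x : ∀ {n} {p : Subset n} x → x ∉ p - x
x∉p-x {p = _ ∷ p} (suc x) (there x∈p-x) = x∉p-x x x∈p-x

∣p++q∣≡∣p∣+∣q∣ : ∀ {m n} (p : Subset m) (q : Subset n) → ∣ p ++ q ∣ ≡ ∣ p ∣ + ∣ q ∣
∣p++q∣≡∣p∣+∣q∣ []            q = refl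
∣p++q∣≡∣p∣+∣q∣ (inside  ∷ p) q = cong suc (∣p++q∣≡∣p∣+∣q∣ p q)
∣p++q∣≡∣p∣+∣q∣ (outside ∷ p) q = ∣p++q∣≡∣p∣+∣q∣ p q

+-<-unless-both-attained : ∀ {a b c d} → a ≤ c → b ≤ d → ¬ (c ≤ a × d ≤ b) → a + b < c + d
+-<-unless-both-attained {a} {c = c} a≤c b≤d notBoth with c ℕ.≤? a
... | yes c≤a = ℕ.+-mono-≤-< a≤c (ℕ.≰⇒> λ d≤b → notBoth (c≤a , d≤b))
... | no  c≰a = ℕ.+-mono-<-≤ (ℕ.≰⇒> c≰a) b≤d

m+[o+p]≡q⇒m≡q∸o∸p : ∀ m o p {q} → m + (o + p) ≡ q → m ≡ q ∸ o ∸ p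
m+[o+p]≡q⇒m≡q∸o∸p m o p refl =
  ≡.sym (trans (ℕ.∸-+-assoc (m + (o + p)) o p) (ℕ.m+n∸n≡m m (o + p)))

+-interchange-cancelʳ : ∀ s₁ s₂ w₁ w₂ e {s w n₁ n₂} → s + w ≡ n₁ + n₂ → e + w ≡ w₁ + w₂ →
                        s₁ + w₁ ≡ n₁ → s₂ + w₂ ≡ n₂ → s ≡ s₁ + s₂ + e
+-interchange-cancelʳ s₁ s₂ w₁ w₂ e {s} {w} {n₁} {n₂} s+w e+w s₁+w₁ s₂+w₂ =
  ℕ.+-cancelʳ-≡ w s (s₁ + s₂ + e) (begin
    s + w                 ≡⟨ s+w ⟩
    n₁ + n₂               ≡⟨ cong₂ _+_ s₁+w₁ s₂+w₂ ⟨
    (s₁ + w₁) + (s₂ + w₂) ≡⟨ +-interchange s₁ w₁ s₂ w₂ ⟩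
    (s₁ + s₂) + (w₁ + w₂) ≡⟨ cong (s₁ + s₂ +_) e+w ⟨
    (s₁ + s₂) + (e + w)   ≡⟨ ℕ.+-assoc (s₁ + s₂) e w ⟨
    s₁ + s₂ + e + w       ∎)
  where open ≡.≡-Reasoning

+-interchange-cancelʳ-≤ : ∀ s₁ s₂ w₁ w₂ {s n₁ n₂} → s + (w₁ + w₂) ≡ n₁ + n₂ →
                          s₁ + w₁ ≤ n₁ → s₂ + w₂ ≤ n₂ → s₁ + s₂ ≤ s
+-interchange-cancelʳ-≤ s₁ s₂ w₁ w₂ {s} {n₁} {n₂} s+w s₁+w₁ s₂+w₂ =
  ℕ.+-cancelʳ-≤ (w₁ + w₂) (s₁ + s₂) s (begin
    (s₁ + s₂) + (w₁ + w₂) ≡⟨ +-interchange s₁ s₂ w₁ w₂ ⟩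
    (s₁ + w₁) + (s₂ + w₂) ≤⟨ ℕ.+-mono-≤ s₁+w₁ s₂+w₂ ⟩
    n₁ + n₂               ≡⟨ s+w ⟨
    s + (w₁ + w₂)         ∎)
  where open ℕ.≤-Reasoning

↑ˡ∈++⇔∈ : ∀ {m n} {p : Subset m} {q : Subset n} {x} → x ↑ˡ n ∈ p ++ q ⇔ x ∈ p
↑ˡ∈++⇔∈ {n = n} {p} {q} {x} = mk⇔
  (λ x∈ → lookup⇒[]= x p (trans (≡.sym (lookup-++ˡ p q x)) ([]=⇒lookup x∈)))
  (λ x∈ → lookup⇒[]= (x ↑ˡ n) (p ++ q) (trans (lookup-++ˡ p q x) ([]=⇒lookup x∈)))

↑ʳ∈++⇔∈ : ∀ {m n} {p : Subset m} {q : Subset n} {y} → m ↑ʳ y ∈ p ++ q ⇔ y ∈ q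
↑ʳ∈++⇔∈ {m} {p = p} {q} {y} = mk⇔
  (λ y∈ → lookup⇒[]= y q (trans (≡.sym (lookup-++ʳ p q y)) ([]=⇒lookup y∈)))
  (λ y∈ → lookup⇒[]= (m ↑ʳ y) (p ++ q) (trans (lookup-++ʳ p q y) ([]=⇒lookup y∈)))

module _ {n : ℕ} (X : Graph n) where

  adj-sym : ∀ {u v} → Adj X u v → Adj X v u
  adj-sym {u} {v} = trans (Graph.sym X v u)

  adj? : ∀ u v → Dec (Adj X u v)
  adj? u v = adj X u v ≟ᵇ true

  adj⇒≢ : ∀ {u v} → Adj X u v → u ≢ v
  adj⇒≢ {u} uv refl with trans (≡.sym (irrefl X u)) uv
  ... | ()

  closedNbr? : ∀ u w → Dec (ClosedNbr X u w)
  closedNbr? u w = (w ≟ᶠ u) ⊎-dec adj? u w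

  walk? : ∀ k u v → Dec (Walk X u v k)
  walk? zero u v with u ≟ᶠ v
  ... | yes refl = yes nil
  ... | no u≢v = no λ { nil → u≢v refl }
  walk? (suc k) u v with any? (λ x → adj? u x ×-dec walk? k x v)
  ... | yes (x , a , p) = yes (cons a p)
  ... | no ¬p = no λ { (cons a p) → ¬p (_ , a , p) }

  shortest-walk : ∀ {u v k} → Walk X u v k → ∃[ d ] Dist X u v d
  shortest-walk {u} {v} = least-witness (λ k → walk? k u v)

  endpoint-onWalk : ∀ {u v k} (p : Walk X u v k) → OnWalk X v p
  endpoint-onWalk nil        = here
  endpoint-onWalk (cons _ p) = there (endpoint-onWalk p)

  endpoint∈interval : Connected X → ∀ u v → InInterval X u v v
  endpoint∈interval conn u v with shortest-walk (proj₂ (conn u v))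
  ... | d , p , minimal = d , (p , endpoint-onWalk p) , minimal

  middle∈interval : ∀ {u v w} → Adj X u v → Adj X v w → ¬ ClosedNbr X u w → InInterval X u w v
  middle∈interval uv vw w∉N[u] = 2 , (cons uv (cons vw nil) , there here) , shorter
    where
    shorter : ∀ j → j < 2 → ¬ Walk X _ _ j
    shorter 0 _ nil             = w∉N[u] (inj₁ refl)
    shorter 1 _ (cons uw nil)   = w∉N[u] (inj₂ uw)
    shorter (suc (suc _)) (s≤s (s≤s ())) _

  PrivateNbr : Fin n → Fin n → Fin n → Set
  PrivateNbr u v w = Adj X u w × ¬ ClosedNbr X v w

  privateNbr⇒¬twins : ∀ {u v w} → PrivateNbr v u w → ¬ TrueTwins X u v
  privateNbr⇒¬twins (vw , w∉N[u]) (_ , twins) = w∉N[u] (proj₂ (twins _) (inj₂ vw))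

  ¬twins⇒privateNbr : ∀ {u v} → Adj X u v → ¬ TrueTwins X u v →
                      ∃ (PrivateNbr u v) ⊎ ∃ (PrivateNbr v u)
  ¬twins⇒privateNbr {u} {v} uv ¬twins
    with ¬∀⟶∃¬ n _ (λ w → (closedNbr? u w →-dec closedNbr? v w) ×-dec
                          (closedNbr? v w →-dec closedNbr? u w))
                   (λ same → ¬twins (adj⇒≢ uv , same))
  ... | w , differ with closedNbr? u w | closedNbr? v w
  ... | yes inU | yes inV = ⊥-elim (differ ((λ _ → inV) , (λ _ → inU)))
  ... | no ∉U   | no ∉V   = ⊥-elim (differ ((λ inU → ⊥-elim (∉U inU)) , (λ inV → ⊥-elim (∉V inV))))
  ... | yes (inj₁ refl) | no ∉V = ⊥-elim (∉V (inj₂ (adj-sym uv)))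
  ... | yes (inj₂ uw)   | no ∉V = inj₁ (w , uw , ∉V)
  ... | no ∉U | yes (inj₁ refl) = ⊥-elim (∉U (inj₂ uv))
  ... | no ∉U | yes (inj₂ vw)   = inj₂ (w , vw , ∉U)

  twins-sym : ∀ {u v} → TrueTwins X u v → TrueTwins X v u
  twins-sym (u≢v , same) = u≢v ∘ ≡.sym , λ w → proj₂ (same w) , proj₁ (same w)

  privateNbr∉clique : ∀ {C u v w} → IsClique X C → v ∈ C → PrivateNbr u v w → w ∉ C
  privateNbr∉clique {v = v} {w} clique v∈C (_ , w∉N[v]) w∈C with w ≟ᶠ v
  ... | yes w≡v = w∉N[v] (inj₁ w≡v)
  ... | no  w≢v = w∉N[v] (inj₂ (clique _ _ v∈C w∈C (w≢v ∘ ≡.sym)))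

  ∁twinFreeClique-resolving : Connected X → ∀ {C} → TwinFreeClique X C → StrongResolvingSet X (∁ C)
  ∁twinFreeClique-resolving conn {C} (clique , twinFree) u v u≢v with u ∈? C | v ∈? C
  ... | no u∉C | _      = u , x∉p⇒x∈∁p u∉C , inj₂ (endpoint∈interval conn v u)
  ... | yes _  | no v∉C = v , x∉p⇒x∈∁p v∉C , inj₁ (endpoint∈interval conn u v)
  ... | yes u∈C | yes v∈C = resolvedInClique (clique u v u∈C v∈C u≢v)
    where
    resolvedInClique : Adj X u v → ∃[ w ] (w ∈ ∁ C × StronglyResolves X w u v)
    resolvedInClique uv with ¬twins⇒privateNbr uv (twinFree u v u∈C v∈C)
    ... | inj₁ (w , pn@(uw , w∉N[v])) =
          w , x∉p⇒x∈∁p (privateNbr∉clique clique v∈C pn) , inj₂ (middle∈interval (adj-sym uv) uw w∉N[v])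
    ... | inj₂ (w , pn@(vw , w∉N[u])) =
          w , x∉p⇒x∈∁p (privateNbr∉clique clique u∈C pn) , inj₁ (middle∈interval uv vw w∉N[u])

  DiamAtMost2 : Set
  DiamAtMost2 = ∀ u v d → Dist X u v d → d ≤ 2

  geodesic≤2-inner : ∀ {u v w k} (p : Walk X u w k) → OnWalk X v p → k ≤ 2 →
                     (∀ j → j < k → ¬ Walk X u w j) → v ≢ u → v ≢ w → Adj X u v × PrivateNbr v u w
  geodesic≤2-inner nil        here _ _ v≢u _ = ⊥-elim (v≢u refl)
  geodesic≤2-inner (cons _ _) here _ _ v≢u _ = ⊥-elim (v≢u refl)
  geodesic≤2-inner (cons _ nil) (there here) _ _ _ v≢w = ⊥-elim (v≢w refl)
  geodesic≤2-inner (cons uv (cons vw nil)) (there here) _ minimal _ _ = uv , vw , w∉N[u]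
    where
    w∉N[u] : ¬ ClosedNbr X _ _
    w∉N[u] (inj₁ refl) = minimal 0 (s≤s z≤n) nil
    w∉N[u] (inj₂ uw)   = minimal 1 (s≤s (s≤s z≤n)) (cons uw nil)
  geodesic≤2-inner (cons _ (cons _ nil)) (there (there here)) _ _ _ v≢w = ⊥-elim (v≢w refl)
  geodesic≤2-inner (cons _ (cons _ (cons _ _))) _ (s≤s (s≤s ())) _ _ _

  between⇒privateNbr : DiamAtMost2 → ∀ {u v w} → v ≢ u → v ≢ w → InInterval X u w v →
                       Adj X u v × PrivateNbr v u w
  between⇒privateNbr diam v≢u v≢w (k , (p , v∈p) , minimal) =
    geodesic≤2-inner p v∈p (diam _ _ k (p , minimal)) minimal v≢u v≢w

  ∁resolving-twinFreeClique : DiamAtMost2 → ∀ {S} → StrongResolvingSet X S → TwinFreeClique X (∁ S)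
  ∁resolving-twinFreeClique diam {S} resolving =
    (λ u v u∈ v∈ u≢v → proj₁ (separated u∈ v∈ u≢v)) ,
    (λ u v u∈ v∈ twins → proj₂ (separated u∈ v∈ (proj₁ twins)) twins)
    where
    ∉S : ∀ {u w} → u ∈ ∁ S → w ∈ S → u ≢ w
    ∉S u∈∁S w∈S refl = x∈∁p⇒x∉p u∈∁S w∈S
    separated : ∀ {u v} → u ∈ ∁ S → v ∈ ∁ S → u ≢ v → Adj X u v × ¬ TrueTwins X u v
    separated {u} {v} u∈ v∈ u≢v with resolving u v u≢v
    ... | w , w∈S , inj₁ v∈I[u,w]
      with between⇒privateNbr diam (u≢v ∘ ≡.sym) (∉S v∈ w∈S) v∈I[u,w]
    ...   | uv , pn = uv , privateNbr⇒¬twins pn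
    separated {u} {v} u∈ v∈ u≢v | w , w∈S , inj₂ u∈I[v,w]
      with between⇒privateNbr diam u≢v (∉S u∈ w∈S) u∈I[v,w]
    ...   | vu , pn = adj-sym vu , privateNbr⇒¬twins pn ∘ twins-sym

  dim+ϖ≤n : Connected X → ∀ {s w} → StrongMetricDim X s → TwinFreeCliqueNumber X w → s + w ≤ n
  dim+ϖ≤n conn {s} (_ , minimum) ((C , twinFree , refl) , _) = begin
    s + ∣ C ∣       ≤⟨ ℕ.+-monoˡ-≤ ∣ C ∣ (minimum (∁ C) (∁twinFreeClique-resolving conn twinFree)) ⟩
    ∣ ∁ C ∣ + ∣ C ∣ ≡⟨ ℕ.+-comm ∣ ∁ C ∣ ∣ C ∣ ⟩
    ∣ C ∣ + ∣ ∁ C ∣ ≡⟨ ∣p∣+∣∁p∣≡n C ⟩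
    n               ∎
    where open ℕ.≤-Reasoning

  n≤dim+ϖ : DiamAtMost2 → ∀ {s w} → StrongMetricDim X s → TwinFreeCliqueNumber X w → n ≤ s + w
  n≤dim+ϖ diam {w = w} ((S , resolving , refl) , _) (_ , maximum) = begin
    n               ≡⟨ ∣p∣+∣∁p∣≡n S ⟨
    ∣ S ∣ + ∣ ∁ S ∣ ≤⟨ ℕ.+-monoʳ-≤ ∣ S ∣ (maximum (∁ S) (∁resolving-twinFreeClique diam resolving)) ⟩
    ∣ S ∣ + w       ∎
    where open ℕ.≤-Reasoning

  dim+ϖ≡n : Connected X → DiamAtMost2 → ∀ {s w} → StrongMetricDim X s → TwinFreeCliqueNumber X w →
            s + w ≡ n
  dim+ϖ≡n conn diam dim ϖ = ℕ.≤-antisym (dim+ϖ≤n conn dim ϖ) (n≤dim+ϖ diam dim ϖ)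

  Universal : Fin n → Set
  Universal u = ∀ w → ClosedNbr X u w

  HasUniversal : Set
  HasUniversal = ∃ Universal

  UniversalIn : Subset n → Set
  UniversalIn p = ∃[ u ] (u ∈ p × Universal u)

  universal? : ∀ u → Dec (Universal u)
  universal? u = all? (closedNbr? u)

  universal-adj : ∀ {u w} → Universal u → w ≢ u → Adj X u w
  universal-adj {w = w} U w≢u with U w
  ... | inj₁ w≡u = contradiction w≡u w≢u
  ... | inj₂ uw  = uw

  universals-twins : ∀ {u v} → u ≢ v → Universal u → Universal v → TrueTwins X u v
  universals-twins u≢v Uu Uv = u≢v , λ w → (λ _ → Uv w) , (λ _ → Uu w)

  universal-twin : ∀ {u v} → Universal u → TrueTwins X u v → Universal v
  universal-twin U (_ , same) w = proj₁ (same w) (U w)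

  ∈tabulate⇒true : ∀ (f : Fin n → Bool) {c} → c ∈ tabulate f → f c ≡ true
  ∈tabulate⇒true f {c} c∈ = trans (≡.sym (lookup∘tabulate f c)) ([]=⇒lookup c∈)

  true⇒∈tabulate : ∀ (f : Fin n → Bool) {c} → f c ≡ true → c ∈ tabulate f
  true⇒∈tabulate f {c} fc = lookup⇒[]= c (tabulate f) (trans (lookup∘tabulate f c) fc)

  neighbours⊆∁⁅v⁆ : ∀ v → tabulate (adj X v) ⊆ ∁ ⁅ v ⁆
  neighbours⊆∁⁅v⁆ v c∈N = x∉p⇒x∈∁p λ c∈⁅v⁆ →
    adj⇒≢ (∈tabulate⇒true (adj X v) c∈N) (≡.sym (x∈⁅y⁆⇒x≡y v c∈⁅v⁆))

  ∣∁⁅v⁆∣≡n∸1 : ∀ v → ∣ ∁ ⁅ v ⁆ ∣ ≡ n ∸ 1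
  ∣∁⁅v⁆∣≡n∸1 v = trans (∣∁p∣≡n∸∣p∣ ⁅ v ⁆) (cong (n ∸_) (∣⁅x⁆∣≡1 v))

  degree≤n∸1 : ∀ v → degree X v ≤ n ∸ 1
  degree≤n∸1 v = subst (degree X v ≤_) (∣∁⁅v⁆∣≡n∸1 v) (p⊆q⇒∣p∣≤∣q∣ (neighbours⊆∁⁅v⁆ v))

  universal⇒degree≡n∸1 : ∀ {u} → Universal u → degree X u ≡ n ∸ 1
  universal⇒degree≡n∸1 {u} U = ℕ.≤-antisym (degree≤n∸1 u)
    (subst (_≤ degree X u) (∣∁⁅v⁆∣≡n∸1 u) (p⊆q⇒∣p∣≤∣q∣ ∁⁅u⁆⊆neighbours))
    where
    ∁⁅u⁆⊆neighbours : ∁ ⁅ u ⁆ ⊆ tabulate (adj X u)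
    ∁⁅u⁆⊆neighbours c∈ = true⇒∈tabulate (adj X u) (universal-adj U (x∉⁅y⁆⇒x≢y (x∈∁p⇒x∉p c∈)))

  degree≡n∸1⇒universal : ∀ {u} → degree X u ≡ n ∸ 1 → Universal u
  degree≡n∸1⇒universal {u} deg c with c ≟ᶠ u | adj? u c
  ... | yes c≡u | _      = inj₁ c≡u
  ... | no _    | yes uc = inj₂ uc
  ... | no c≢u  | no ¬uc =
    contradiction (trans deg (≡.sym (∣∁⁅v⁆∣≡n∸1 u))) (ℕ.<⇒≢ (p⊂q⇒∣p∣<∣q∣ N⊂∁⁅u⁆))
    where
    N⊂∁⁅u⁆ : tabulate (adj X u) ⊂ ∁ ⁅ u ⁆
    N⊂∁⁅u⁆ = neighbours⊆∁⁅v⁆ u , c , x∉p⇒x∈∁p (x≢y⇒x∉⁅y⁆ c≢u) , ¬uc ∘ ∈tabulate⇒true (adj X u)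

  universal⇒maxDegree≡n∸1 : ∀ {Δ} → MaxDegree X Δ → ∀ {u} → Universal u → Δ ≡ n ∸ 1
  universal⇒maxDegree≡n∸1 ((v , refl) , maximal) {u} U =
    ℕ.≤-antisym (degree≤n∸1 v) (subst (_≤ degree X v) (universal⇒degree≡n∸1 U) (maximal u))

  maxDegree≡n∸1⇒universal : ∀ {Δ} → MaxDegree X Δ → Δ ≡ n ∸ 1 → HasUniversal
  maxDegree≡n∸1⇒universal ((v , refl) , _) deg = v , degree≡n∸1⇒universal deg

  WithinTwoSteps : Set
  WithinTwoSteps = ∀ u v → ∃[ k ] (k ≤ 2 × Walk X u v k)

  withinTwoSteps⇒connected : WithinTwoSteps → Connected X
  withinTwoSteps⇒connected near u v = proj₁ (near u v) , proj₂ (proj₂ (near u v))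

  withinTwoSteps⇒diam≤2 : WithinTwoSteps → DiamAtMost2
  withinTwoSteps⇒diam≤2 near u v d (_ , minimal) with near u v
  ... | k , k≤2 , p = ℕ.≤-trans (ℕ.≮⇒≥ (λ k<d → minimal k k<d p)) k≤2

  universal⇒withinTwoSteps : ∀ {c} → Universal c → WithinTwoSteps
  universal⇒withinTwoSteps U u v with U u | U v
  ... | inj₁ refl | inj₁ refl = 0 , z≤n , nil
  ... | inj₁ refl | inj₂ cv   = 1 , s≤s z≤n , cons cv nil
  ... | inj₂ cu   | inj₁ refl = 1 , s≤s z≤n , cons (adj-sym cu) nil
  ... | inj₂ cu   | inj₂ cv   = 2 , s≤s (s≤s z≤n) , cons (adj-sym cu) (cons cv nil)

  universal⇒dim+ϖ≡n : HasUniversal → ∀ {s w} → StrongMetricDim X s → TwinFreeCliqueNumber X w →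
                      s + w ≡ n
  universal⇒dim+ϖ≡n (_ , U) = dim+ϖ≡n (withinTwoSteps⇒connected near) (withinTwoSteps⇒diam≤2 near)
    where
    near : WithinTwoSteps
    near = universal⇒withinTwoSteps U

  twinFreeClique-⊆ : ∀ {p q} → q ⊆ p → TwinFreeClique X p → TwinFreeClique X q
  twinFreeClique-⊆ q⊆p (clique , twinFree) =
    (λ u v u∈ v∈ → clique u v (q⊆p u∈) (q⊆p v∈)) , (λ u v u∈ v∈ → twinFree u v (q⊆p u∈) (q⊆p v∈))

  twinFreeClique-∪-universal : ∀ {p u} → TwinFreeClique X p → Universal u → ¬ UniversalIn p →
                               TwinFreeClique X (p ∪ ⁅ u ⁆)
  twinFreeClique-∪-universal {p} {u} (clique , twinFree) U none = clique′ , twinFree′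
    where
    cases : ∀ {x} → x ∈ p ∪ ⁅ u ⁆ → x ∈ p ⊎ x ≡ u
    cases x∈ with x∈p∪q⁻ p ⁅ u ⁆ x∈
    ... | inj₁ x∈p = inj₁ x∈p
    ... | inj₂ x∈u = inj₂ (x∈⁅y⁆⇒x≡y u x∈u)
    clique′ : IsClique X (p ∪ ⁅ u ⁆)
    clique′ x y x∈ y∈ x≢y with cases x∈ | cases y∈
    ... | inj₁ x∈p | inj₁ y∈p = clique x y x∈p y∈p x≢y
    ... | inj₁ _   | inj₂ refl = adj-sym (universal-adj U x≢y)
    ... | inj₂ refl | _        = universal-adj U (x≢y ∘ ≡.sym)
    twinFree′ : ∀ x y → x ∈ p ∪ ⁅ u ⁆ → y ∈ p ∪ ⁅ u ⁆ → ¬ TrueTwins X x y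
    twinFree′ x y x∈ y∈ twins with cases x∈ | cases y∈
    ... | inj₁ x∈p  | inj₁ y∈p  = twinFree x y x∈p y∈p twins
    ... | inj₁ x∈p  | inj₂ refl = none (x , x∈p , universal-twin U (twins-sym twins))
    ... | inj₂ refl | inj₁ y∈p  = none (y , y∈p , universal-twin U twins)
    ... | inj₂ refl | inj₂ refl = proj₁ twins refl

  maximum-twinFreeClique∋universal : ∀ {w p} → TwinFreeCliqueNumber X w → TwinFreeClique X p →
                                     w ≤ ∣ p ∣ → HasUniversal → UniversalIn p
  maximum-twinFreeClique∋universal {p = p} (_ , maximum) twinFree w≤∣p∣ (u , U)
    with any? (λ y → (y ∈? p) ×-dec universal? y)
  ... | yes found = found
  ... | no none = contradiction (ℕ.≤-trans ∣p∪u∣≤w w≤∣p∣) (ℕ.<⇒≱ (p⊂q⇒∣p∣<∣q∣ p⊂p∪u))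
    where
    ∣p∪u∣≤w : ∣ p ∪ ⁅ u ⁆ ∣ ≤ _
    ∣p∪u∣≤w = maximum _ (twinFreeClique-∪-universal twinFree U none)
    p⊂p∪u : p ⊂ p ∪ ⁅ u ⁆
    p⊂p∪u = p⊆p∪q ⁅ u ⁆ , u , q⊆p∪q p ⁅ u ⁆ (x∈⁅x⁆ u) , λ u∈p → none (u , u∈p , U)

  twinFreeClique-universal-removed : ∀ {p y} → TwinFreeClique X p → y ∈ p → Universal y →
                                     ¬ UniversalIn (p - y)
  twinFreeClique-universal-removed {p} {y} (_ , twinFree) y∈p Uy (x , x∈p-y , Ux) =
    twinFree x y (p─q⊆p p ⁅ y ⁆ x∈p-y) y∈p (universals-twins x≢y Ux Uy)
    where
    x≢y : x ≢ y
    x≢y refl = x∉p-x x x∈p-y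

module Join {n₁ n₂ : ℕ} (G : Graph n₁) (H : Graph n₂) where

  J : Graph (n₁ + n₂)
  J = G +ᴳ H

  data Side : Fin (n₁ + n₂) → Set where
    inG : ∀ a → Side (a ↑ˡ n₂)
    inH : ∀ b → Side (n₁ ↑ʳ b)

  side : ∀ x → Side x
  side x with splitAt n₁ x in eq
  ... | inj₁ a = subst Side (splitAt⁻¹-↑ˡ eq) (inG a)
  ... | inj₂ b = subst Side (splitAt⁻¹-↑ʳ eq) (inH b)

  adj-GG : ∀ a c → adj J (a ↑ˡ n₂) (c ↑ˡ n₂) ≡ adj G a c
  adj-GG a c = cong₂ (joinAdj G H) (splitAt-↑ˡ n₁ a n₂) (splitAt-↑ˡ n₁ c n₂)

  adj-HH : ∀ b d → adj J (n₁ ↑ʳ b) (n₁ ↑ʳ d) ≡ adj H b d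
  adj-HH b d = cong₂ (joinAdj G H) (splitAt-↑ʳ n₁ n₂ b) (splitAt-↑ʳ n₁ n₂ d)

  adj-GH : ∀ a b → Adj J (a ↑ˡ n₂) (n₁ ↑ʳ b)
  adj-GH a b = cong₂ (joinAdj G H) (splitAt-↑ˡ n₁ a n₂) (splitAt-↑ʳ n₁ n₂ b)

  adj-HG : ∀ b a → Adj J (n₁ ↑ʳ b) (a ↑ˡ n₂)
  adj-HG b a = cong₂ (joinAdj G H) (splitAt-↑ʳ n₁ n₂ b) (splitAt-↑ˡ n₁ a n₂)

  closedNbr-GG : ∀ {a c} → ClosedNbr J (a ↑ˡ n₂) (c ↑ˡ n₂) ⇔ ClosedNbr G a c
  closedNbr-GG {a} {c} = mk⇔ (Sum.map (↑ˡ-injective n₂ c a) (trans (≡.sym (adj-GG a c))))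
                              (Sum.map (cong (_↑ˡ n₂)) (trans (adj-GG a c)))

  closedNbr-HH : ∀ {b d} → ClosedNbr J (n₁ ↑ʳ b) (n₁ ↑ʳ d) ⇔ ClosedNbr H b d
  closedNbr-HH {b} {d} = mk⇔ (Sum.map (↑ʳ-injective n₁ d b) (trans (≡.sym (adj-HH b d))))
                              (Sum.map (cong (n₁ ↑ʳ_)) (trans (adj-HH b d)))

  twins-GG : ∀ {a c} → TrueTwins J (a ↑ˡ n₂) (c ↑ˡ n₂) ⇔ TrueTwins G a c
  twins-GG {a} {c} = mk⇔
    (λ (a≢c , same) → a≢c ∘ cong (_↑ˡ n₂) , λ e →
       (to closedNbr-GG ∘ proj₁ (same (e ↑ˡ n₂)) ∘ from closedNbr-GG) ,
       (to closedNbr-GG ∘ proj₂ (same (e ↑ˡ n₂)) ∘ from closedNbr-GG))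
    (λ (a≢c , same) → a≢c ∘ ↑ˡ-injective n₂ a c , λ z → lift same (side z))
    where
    open Equivalence
    lift : (∀ e → (ClosedNbr G a e → ClosedNbr G c e) × (ClosedNbr G c e → ClosedNbr G a e)) →
           ∀ {z} → Side z → (ClosedNbr J (a ↑ˡ n₂) z → ClosedNbr J (c ↑ˡ n₂) z) ×
                            (ClosedNbr J (c ↑ˡ n₂) z → ClosedNbr J (a ↑ˡ n₂) z)
    lift same (inG e) = (from closedNbr-GG ∘ proj₁ (same e) ∘ to closedNbr-GG) ,
                        (from closedNbr-GG ∘ proj₂ (same e) ∘ to closedNbr-GG)
    lift same (inH d) = (λ _ → inj₂ (adj-GH c d)) , (λ _ → inj₂ (adj-GH a d))

  twins-HH : ∀ {b d} → TrueTwins J (n₁ ↑ʳ b) (n₁ ↑ʳ d) ⇔ TrueTwins H b d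
  twins-HH {b} {d} = mk⇔
    (λ (b≢d , same) → b≢d ∘ cong (n₁ ↑ʳ_) , λ e →
       (to closedNbr-HH ∘ proj₁ (same (n₁ ↑ʳ e)) ∘ from closedNbr-HH) ,
       (to closedNbr-HH ∘ proj₂ (same (n₁ ↑ʳ e)) ∘ from closedNbr-HH))
    (λ (b≢d , same) → b≢d ∘ ↑ʳ-injective n₁ b d , λ z → lift same (side z))
    where
    open Equivalence
    lift : (∀ e → (ClosedNbr H b e → ClosedNbr H d e) × (ClosedNbr H d e → ClosedNbr H b e)) →
           ∀ {z} → Side z → (ClosedNbr J (n₁ ↑ʳ b) z → ClosedNbr J (n₁ ↑ʳ d) z) ×
                            (ClosedNbr J (n₁ ↑ʳ d) z → ClosedNbr J (n₁ ↑ʳ b) z)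
    lift same (inH e) = (from closedNbr-HH ∘ proj₁ (same e) ∘ to closedNbr-HH) ,
                        (from closedNbr-HH ∘ proj₂ (same e) ∘ to closedNbr-HH)
    lift same (inG c) = (λ _ → inj₂ (adj-HG d c)) , (λ _ → inj₂ (adj-HG b c))

  ↑ˡ≢↑ʳ : ∀ {a b} → a ↑ˡ n₂ ≢ n₁ ↑ʳ b
  ↑ˡ≢↑ʳ {a} {b} e with trans (≡.sym (splitAt-↑ˡ n₁ a n₂)) (trans (cong (splitAt n₁) e) (splitAt-↑ʳ n₁ n₂ b))
  ... | ()

  universal-inG : ∀ {a} → Universal G a → Universal J (a ↑ˡ n₂)
  universal-inG {a} U z = nbr (side z)
    where
    nbr : ∀ {z} → Side z → ClosedNbr J (a ↑ˡ n₂) z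
    nbr (inG c) = Equivalence.from closedNbr-GG (U c)
    nbr (inH d) = inj₂ (adj-GH a d)

  universal-inH : ∀ {b} → Universal H b → Universal J (n₁ ↑ʳ b)
  universal-inH {b} U z = nbr (side z)
    where
    nbr : ∀ {z} → Side z → ClosedNbr J (n₁ ↑ʳ b) z
    nbr (inH d) = Equivalence.from closedNbr-HH (U d)
    nbr (inG c) = inj₂ (adj-HG b c)

  twins-GH⇒universal : ∀ {a b} → TrueTwins J (a ↑ˡ n₂) (n₁ ↑ʳ b) → Universal G a × Universal H b
  twins-GH⇒universal {a} {b} (_ , same) =
    (λ c → Equivalence.to closedNbr-GG (proj₂ (same (c ↑ˡ n₂)) (inj₂ (adj-HG b c)))) ,
    (λ d → Equivalence.to closedNbr-HH (proj₁ (same (n₁ ↑ʳ d)) (inj₂ (adj-GH a d))))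

  UniversalPair : Subset n₁ → Subset n₂ → Set
  UniversalPair p q = UniversalIn G p × UniversalIn H q

  twinFreeClique-++⁻ : ∀ {p q} → TwinFreeClique J (p ++ q) →
                       TwinFreeClique G p × TwinFreeClique H q × ¬ UniversalPair p q
  twinFreeClique-++⁻ {p} {q} (clique , twinFree) =
    (cliqueG , twinFreeG) , (cliqueH , twinFreeH) , noPair
    where
    open Equivalence
    cliqueG : IsClique G p
    cliqueG a c a∈ c∈ a≢c = trans (≡.sym (adj-GG a c))
      (clique _ _ (from ↑ˡ∈++⇔∈ a∈) (from ↑ˡ∈++⇔∈ c∈) (a≢c ∘ ↑ˡ-injective n₂ a c))
    twinFreeG : ∀ a c → a ∈ p → c ∈ p → ¬ TrueTwins G a c
    twinFreeG a c a∈ c∈ = twinFree _ _ (from ↑ˡ∈++⇔∈ a∈) (from ↑ˡ∈++⇔∈ c∈) ∘ from twins-GG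
    cliqueH : IsClique H q
    cliqueH b d b∈ d∈ b≢d = trans (≡.sym (adj-HH b d))
      (clique _ _ (from ↑ʳ∈++⇔∈ b∈) (from ↑ʳ∈++⇔∈ d∈) (b≢d ∘ ↑ʳ-injective n₁ b d))
    twinFreeH : ∀ b d → b ∈ q → d ∈ q → ¬ TrueTwins H b d
    twinFreeH b d b∈ d∈ = twinFree _ _ (from ↑ʳ∈++⇔∈ b∈) (from ↑ʳ∈++⇔∈ d∈) ∘ from twins-HH
    noPair : ¬ UniversalPair p q
    noPair ((a , a∈ , Ua) , (b , b∈ , Ub)) = twinFree _ _ (from ↑ˡ∈++⇔∈ a∈) (from ↑ʳ∈++⇔∈ b∈)
      (universals-twins J ↑ˡ≢↑ʳ (universal-inG Ua) (universal-inH Ub))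

  twinFreeClique-++⁺ : ∀ {p q} → TwinFreeClique G p → TwinFreeClique H q → ¬ UniversalPair p q →
                       TwinFreeClique J (p ++ q)
  twinFreeClique-++⁺ {p} {q} (cliqueG , twinFreeG) (cliqueH , twinFreeH) noPair =
    (λ x y x∈ y∈ → adjacent (side x) (side y) x∈ y∈) , (λ x y x∈ y∈ → separated (side x) (side y) x∈ y∈)
    where
    open Equivalence
    adjacent : ∀ {x y} → Side x → Side y → x ∈ p ++ q → y ∈ p ++ q → x ≢ y → Adj J x y
    adjacent (inG a) (inG c) a∈ c∈ a≢c =
      trans (adj-GG a c) (cliqueG a c (to ↑ˡ∈++⇔∈ a∈) (to ↑ˡ∈++⇔∈ c∈) (a≢c ∘ cong (_↑ˡ n₂)))
    adjacent (inG a) (inH b) _ _ _ = adj-GH a b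
    adjacent (inH b) (inG a) _ _ _ = adj-HG b a
    adjacent (inH b) (inH d) b∈ d∈ b≢d =
      trans (adj-HH b d) (cliqueH b d (to ↑ʳ∈++⇔∈ b∈) (to ↑ʳ∈++⇔∈ d∈) (b≢d ∘ cong (n₁ ↑ʳ_)))
    separated : ∀ {x y} → Side x → Side y → x ∈ p ++ q → y ∈ p ++ q → ¬ TrueTwins J x y
    separated (inG a) (inG c) a∈ c∈ = twinFreeG a c (to ↑ˡ∈++⇔∈ a∈) (to ↑ˡ∈++⇔∈ c∈) ∘ to twins-GG
    separated (inG a) (inH b) a∈ b∈ twins with twins-GH⇒universal twins
    ... | Ua , Ub = noPair ((a , to ↑ˡ∈++⇔∈ a∈ , Ua) , (b , to ↑ʳ∈++⇔∈ b∈ , Ub))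
    separated (inH b) (inG a) b∈ a∈ twins with twins-GH⇒universal (twins-sym J twins)
    ... | Ua , Ub = noPair ((a , to ↑ˡ∈++⇔∈ a∈ , Ua) , (b , to ↑ʳ∈++⇔∈ b∈ , Ub))
    separated (inH b) (inH d) b∈ d∈ = twinFreeH b d (to ↑ʳ∈++⇔∈ b∈) (to ↑ʳ∈++⇔∈ d∈) ∘ to twins-HH

  ∣twinFreeClique∣≤ : ∀ {w} → (∀ {p q} → TwinFreeClique G p → TwinFreeClique H q → ¬ UniversalPair p q →
                                ∣ p ∣ + ∣ q ∣ ≤ w) →
                      ∀ C → TwinFreeClique J C → ∣ C ∣ ≤ w
  ∣twinFreeClique∣≤ bound C twinFree
    with twinFreeClique-++⁻ {take n₁ C} {drop n₁ C} (subst (TwinFreeClique J) C≡p++q twinFree)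
    where
    C≡p++q : C ≡ take n₁ C ++ drop n₁ C
    C≡p++q = ≡.sym (take++drop≡id n₁ C)
  ... | twinFreeG , twinFreeH , noPair =
    subst (_≤ _) (≡.sym ∣C∣≡) (bound twinFreeG twinFreeH noPair)
    where
    ∣C∣≡ : ∣ C ∣ ≡ ∣ take n₁ C ∣ + ∣ drop n₁ C ∣
    ∣C∣≡ = trans (cong ∣_∣ (≡.sym (take++drop≡id n₁ C))) (∣p++q∣≡∣p∣+∣q∣ (take n₁ C) (drop n₁ C))

  twinFreeCliqueNumber-join : ¬ (HasUniversal G × HasUniversal H) → ∀ {w₁ w₂} →
                              TwinFreeCliqueNumber G w₁ → TwinFreeCliqueNumber H w₂ →
                              TwinFreeCliqueNumber J (w₁ + w₂)
  twinFreeCliqueNumber-join noUniversals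
    ((A , twinFreeA , refl) , maximumG) ((B , twinFreeB , refl) , maximumH) =
    (A ++ B , twinFreeClique-++⁺ twinFreeA twinFreeB noPair , ∣p++q∣≡∣p∣+∣q∣ A B) ,
    ∣twinFreeClique∣≤ (λ twinFreeG twinFreeH _ → ℕ.+-mono-≤ (maximumG _ twinFreeG) (maximumH _ twinFreeH))
    where
    noPair : ¬ UniversalPair A B
    noPair ((a , _ , Ua) , (b , _ , Ub)) = noUniversals ((a , Ua) , (b , Ub))

  twinFreeCliqueNumber-join-universal : HasUniversal G → HasUniversal H → ∀ {w₁ w₂} →
                                        TwinFreeCliqueNumber G w₁ → TwinFreeCliqueNumber H w₂ →
                                        ∃[ w ] (TwinFreeCliqueNumber J w × suc w ≡ w₁ + w₂)
  twinFreeCliqueNumber-join-universal uG uH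
    ϖG@((A , twinFreeA , refl) , maximumG) ϖH@((B , twinFreeB , refl) , maximumH)
    with maximum-twinFreeClique∋universal H ϖH twinFreeB ℕ.≤-refl uH
  ... | y , y∈B , Uy =
    ∣ A ∣ + ∣ B - y ∣ ,
    ((A ++ (B - y) , twinFreeClique-++⁺ twinFreeA twinFreeB-y noPair , ∣p++q∣≡∣p∣+∣q∣ A (B - y)) ,
     ∣twinFreeClique∣≤ bound) ,
    size
    where
    twinFreeB-y : TwinFreeClique H (B - y)
    twinFreeB-y = twinFreeClique-⊆ H (p─q⊆p B ⁅ y ⁆) twinFreeB
    noPair : ¬ UniversalPair A (B - y)
    noPair = twinFreeClique-universal-removed H twinFreeB y∈B Uy ∘ proj₂
    size : suc (∣ A ∣ + ∣ B - y ∣) ≡ ∣ A ∣ + ∣ B ∣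
    size = trans (≡.sym (ℕ.+-suc ∣ A ∣ ∣ B - y ∣)) (cong (∣ A ∣ +_) (≡.sym (x∈p⇒∣p∣≡1+∣p-x∣ y∈B)))
    bound : ∀ {p q} → TwinFreeClique G p → TwinFreeClique H q → ¬ UniversalPair p q →
            ∣ p ∣ + ∣ q ∣ ≤ ∣ A ∣ + ∣ B - y ∣
    bound {p} {q} twinFreeG twinFreeH noPair′ =
      ℕ.≤-pred (subst (∣ p ∣ + ∣ q ∣ <_) (≡.sym size)
        (+-<-unless-both-attained (maximumG _ twinFreeG) (maximumH _ twinFreeH) λ (A≤p , B≤q) →
          noPair′ (maximum-twinFreeClique∋universal G ϖG twinFreeG A≤p uG ,
                   maximum-twinFreeClique∋universal H ϖH twinFreeH B≤q uH)))

  withinTwoSteps : Fin n₁ → Fin n₂ → WithinTwoSteps J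
  withinTwoSteps g h x y = steps (side x) (side y)
    where
    steps : ∀ {x y} → Side x → Side y → ∃[ k ] (k ≤ 2 × Walk J x y k)
    steps (inG a) (inG c) = 2 , ℕ.≤-refl , cons (adj-GH a h) (cons (adj-HG h c) nil)
    steps (inG a) (inH b) = 1 , s≤s z≤n , cons (adj-GH a b) nil
    steps (inH b) (inG a) = 1 , s≤s z≤n , cons (adj-HG b a) nil
    steps (inH b) (inH d) = 2 , ℕ.≤-refl , cons (adj-HG b g) (cons (adj-GH g d) nil)

theorem4 : ∀ {n₁ n₂} (G : Graph n₁) (H : Graph n₂) →
    2 ≤ n₁ → 2 ≤ n₂ → Connected G → Connected H →
    ∀ Δ₁ Δ₂ → MaxDegree G Δ₁ → MaxDegree H Δ₂ →
    ∀ s₁ s₂ s → StrongMetricDim G s₁ → StrongMetricDim H s₂ → StrongMetricDim (G +ᴳ H) s →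
    ∀ w₁ w₂ → TwinFreeCliqueNumber G w₁ → TwinFreeCliqueNumber H w₂ →
    ((Δ₁ ≢ n₁ ∸ 1 ⊎ Δ₂ ≢ n₂ ∸ 1) → (s ≡ n₁ + n₂ ∸ w₁ ∸ w₂) × (s₁ + s₂ ≤ s))
    × (Diameter2 G → Diameter2 H → (Δ₁ ≢ n₁ ∸ 1 ⊎ Δ₂ ≢ n₂ ∸ 1) → s ≡ s₁ + s₂)
    × (Δ₁ ≡ n₁ ∸ 1 → Δ₂ ≡ n₂ ∸ 1 → s ≡ s₁ + s₂ + 1)
theorem4 {n₁} {n₂} G H 2≤n₁ 2≤n₂ connG connH Δ₁ Δ₂ maxG maxH s₁ s₂ s dimG dimH dimJ w₁ w₂ ϖG ϖH =
  (λ notFull → m+[o+p]≡q⇒m≡q∸o∸p s w₁ w₂ (s+ϖG+ϖH notFull) ,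
               +-interchange-cancelʳ-≤ s₁ s₂ w₁ w₂ (s+ϖG+ϖH notFull)
                 (dim+ϖ≤n G connG dimG ϖG) (dim+ϖ≤n H connH dimH ϖH)) ,
  (λ diamG diamH notFull →
     trans (+-interchange-cancelʳ s₁ s₂ w₁ w₂ 0 (s+ϖG+ϖH notFull) refl
              (dim+ϖ≡n G connG (proj₁ diamG) dimG ϖG) (dim+ϖ≡n H connH (proj₁ diamH) dimH ϖH))
           (ℕ.+-identityʳ (s₁ + s₂))) ,
  (λ Δ₁≡ Δ₂≡ → full (maxDegree≡n∸1⇒universal G maxG Δ₁≡) (maxDegree≡n∸1⇒universal H maxH Δ₂≡))
  where
  open Join G H
  nearJ : WithinTwoSteps J
  nearJ = withinTwoSteps (fromℕ< 2≤n₁) (fromℕ< 2≤n₂)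
  s+ϖJ : ∀ {w} → TwinFreeCliqueNumber J w → s + w ≡ n₁ + n₂
  s+ϖJ = dim+ϖ≡n J (withinTwoSteps⇒connected J nearJ) (withinTwoSteps⇒diam≤2 J nearJ) dimJ
  s+ϖG+ϖH : (Δ₁ ≢ n₁ ∸ 1 ⊎ Δ₂ ≢ n₂ ∸ 1) → s + (w₁ + w₂) ≡ n₁ + n₂
  s+ϖG+ϖH notFull = s+ϖJ (twinFreeCliqueNumber-join (notFull⇒¬universals notFull) ϖG ϖH)
    where
    notFull⇒¬universals : (Δ₁ ≢ n₁ ∸ 1 ⊎ Δ₂ ≢ n₂ ∸ 1) → ¬ (HasUniversal G × HasUniversal H)
    notFull⇒¬universals (inj₁ Δ₁≢) ((_ , U) , _) = Δ₁≢ (universal⇒maxDegree≡n∸1 G maxG U)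
    notFull⇒¬universals (inj₂ Δ₂≢) (_ , (_ , U)) = Δ₂≢ (universal⇒maxDegree≡n∸1 H maxH U)
  full : HasUniversal G → HasUniversal H → s ≡ s₁ + s₂ + 1
  full uG uH with twinFreeCliqueNumber-join-universal uG uH ϖG ϖH
  ... | _ , ϖJ , 1+ϖJ≡ =
    +-interchange-cancelʳ s₁ s₂ w₁ w₂ 1 (s+ϖJ ϖJ) 1+ϖJ≡
      (universal⇒dim+ϖ≡n G uG dimG ϖG) (universal⇒dim+ϖ≡n H uH dimH ϖH)
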